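{- Let $G$ be an almost well-covered graph of girth at least $6$. Then no vertex of $G_2$ is adjacent to a vertex of $G_0$.
   Context: All graphs are finite and simple; a graph with no cycles has infinite girth. For a graph $G$, $\alpha(G)$ is the maximum size of an independent set and $i(G)$ is the minimum size of an inclusion-maximal independent set; $G$ is almost well-covered if $\alpha(G)-i(G)=1$. Types: let $U$ be the set of vertices whose connected component in $G$ is a complete graph. In $G-U$, a leaf is a vertex of degree $1$ and an internal vertex is a vertex that is not a leaf. An internal vertex of $G-U$ adjacent to exactly $k$ leaves is of type $k$; every vertex of $U$ is of type $0$. $G_i$ denotes the subgraph of $G$ induced by all vertices of type $i$. -}

module Defs where

open import Data.Nat using (ℕ; zero; suc; _≤_; _<_)
open import Data.Fin using (Fin; toℕ; fromℕ)
import Data.Fin as F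
open import Data.Fin.Subset using (Subset; _∈_; _∉_; ∣_∣)
open import Data.Bool using (Bool; true; false)
open import Data.Product using (Σ; ∃; ∃-syntax; _×_; _,_)
open import Data.Sum using (_⊎_)
open import Relation.Binary.PropositionalEquality using (_≡_; _≢_)
open import Relation.Nullary using (¬_)
open import Function.Definitions using (Injective)

record Graph (n : ℕ) : Set where
  field
    adj    : Fin n → Fin n → Bool
    sym    : ∀ u v → adj u v ≡ adj v u
    irrefl : ∀ v → adj v v ≡ false

open Graph public

module _ {n : ℕ} (G : Graph n) where

  Adj : Fin n → Fin n → Set
  Adj u v = adj G u v ≡ true

  Independent : Subset n → Set
  Independent S = ∀ u v → u ∈ S → v ∈ S → ¬ Adj u v

  MaximalIndependent : Subset n → Set
  MaximalIndependent S =
    Independent S × (∀ v → v ∉ S → ∃[ u ] (u ∈ S × Adj u v))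

  IsAlpha : ℕ → Set
  IsAlpha a = (∃[ S ] (Independent S × ∣ S ∣ ≡ a))
            × (∀ S → Independent S → ∣ S ∣ ≤ a)

  IsIndepDom : ℕ → Set
  IsIndepDom i = (∃[ S ] (MaximalIndependent S × ∣ S ∣ ≡ i))
               × (∀ S → MaximalIndependent S → i ≤ ∣ S ∣)

  AlmostWellCovered : Set
  AlmostWellCovered = ∃[ a ] ∃[ i ] (IsAlpha a × IsIndepDom i × a ≡ suc i)

  -- a cycle of length suc m (required m ≥ 2): distinct vertices f 0 … f m,
  -- consecutive ones adjacent, and f m adjacent to f 0
  Cycle : ℕ → Set
  Cycle m = 2 ≤ m × Σ (Fin (suc m) → Fin n) λ f →
              Injective _≡_ _≡_ f
            × (∀ i j → toℕ j ≡ suc (toℕ i) → Adj (f i) (f j))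
            × Adj (f (fromℕ m)) (f F.zero)

  -- girth ≥ 6: no cycle of length < 6 (acyclic graphs have infinite girth)
  GirthAtLeast6 : Set
  GirthAtLeast6 = ∀ m → suc m < 6 → ¬ Cycle m

  data Reach : Fin n → Fin n → Set where
    here : ∀ {v} → Reach v v
    step : ∀ {u w v} → Adj u w → Reach w v → Reach u v

  -- v ∈ U : the connected component of v is a complete graph
  InU : Fin n → Set
  InU v = ∀ x y → Reach v x → Reach v y → x ≢ y → Adj x y

  Leaf : Fin n → Set
  Leaf v = ¬ InU v × ∃[ w ] (Adj v w × ¬ InU w
                              × (∀ w' → Adj v w' → ¬ InU w' → w' ≡ w))

  Internal : Fin n → Set
  Internal v = ¬ InU v × ¬ Leaf v

  Type0 : Fin n → Set
  Type0 v = InU v ⊎ (Internal v × (∀ w → Adj v w → ¬ Leaf w))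

  Type2 : Fin n → Set
  Type2 v = Internal v × ∃[ l₁ ] ∃[ l₂ ]
              (l₁ ≢ l₂ × Adj v l₁ × Adj v l₂ × Leaf l₁ × Leaf l₂
               × (∀ w → Adj v w → Leaf w → w ≡ l₁ ⊎ w ≡ l₂))

-- Let u have type 2 with leaves l₁, l₂ and let v ~ u have type 0; v ∉ U, since U is a union of
-- components and u ∉ U. Girth ≥ 6 makes u together with all vertices at distance two from v by a
-- path avoiding u an independent set; extend it to a maximal independent set M. Since v has no
-- leaf neighbours, every neighbour y ≠ u of v has a neighbour z ≠ v, which lies in M; so y ∉ M.
-- Exchanging u for l₁, l₂, v in M then gives an independent set of size
-- ∣ M ∣ + 2 ≥ i(G) + 2 = α(G) + 1, which is impossible.

module Submission where

open import Defs hiding (sym)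
open import Data.Bool using (true)
import Data.Bool as Bool
open import Data.Empty using (⊥; ⊥-elim)
open import Data.Fin using (Fin; zero; suc; toℕ; fromℕ; _≟_)
open import Data.Fin.Properties using (any?; all?)
open import Data.Fin.Subset using (Subset; _∈_; _∉_; _⊆_; _∪_; _─_; _-_; ⁅_⁆; ∣_∣; inside; outside)
open import Data.Fin.Subset.Properties
  using (_∈?_; x∈p∪q⁻; x∈p∪q⁺; p⊆p∪q; x∈⁅x⁆; x∈⁅y⁆⇒x≡y; p⊂q⇒∣p∣<∣q∣; ∣p∣≤n; p─⊥≡p; p─q⊆p)
open import Data.Nat using (ℕ; zero; suc; _+_; _≤_; _<_; s≤s; z≤n; _<?_)
open import Data.Nat.Properties
  using (≤-reflexive; ≤-trans; n≤1+n; m≤n+m; +-suc; +-identityʳ; +-monoˡ-≤; <-irrefl; ≤-pred; suc-injective;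
         module ≤-Reasoning)
open import Data.Product using (∃-syntax; _×_; _,_)
open import Data.Sum using (_⊎_; inj₁; inj₂)
open import Data.Vec using (Vec; []; _∷_; here; there; lookup; tabulate)
open import Data.Vec.Properties using ([]=⇒lookup; lookup⇒[]=; lookup∘tabulate)
open import Data.Vec.Relation.Unary.All using ([]; _∷_)
open import Data.Vec.Relation.Unary.AllPairs using ([]; _∷_)
open import Data.Vec.Relation.Unary.Linked using (Linked; [-]; _∷_)
open import Data.Vec.Relation.Unary.Unique.Propositional using (Unique)
open import Data.Vec.Relation.Unary.Unique.Propositional.Properties using (lookup-injective)
open import Function using (_∘_; id)
open import Relation.Binary.PropositionalEquality using (_≡_; _≢_; refl; sym; cong; trans; ≢-sym)
open import Relation.Nullary using (¬_; Dec; yes; no; does)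
open import Relation.Nullary.Decidable
  using (dec-true; decidable-stable; from-yes; ¬?; _×-dec_; _→-dec_; _⊎-dec_)
open import Relation.Unary using (Decidable)

private
  variable
    n : ℕ

module _ {P : Fin n → Set} (P? : Decidable P) where

  subset : Subset n
  subset = tabulate (does ∘ P?)

  ∈-subset⁺ : ∀ {x} → P x → x ∈ subset
  ∈-subset⁺ {x} px = lookup⇒[]= x subset (trans (lookup∘tabulate _ x) (dec-true (P? x) px))

  ∈-subset⁻ : ∀ {x} → x ∈ subset → P x
  ∈-subset⁻ {x} x∈ with P? x | trans (sym (lookup∘tabulate (does ∘ P?) x)) ([]=⇒lookup x∈)
  ... | yes px | _ = px
  ... | no _   | ()

∣p∣≤1+∣p-x∣ : ∀ (p : Subset n) x → ∣ p ∣ ≤ suc ∣ p - x ∣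
∣p∣≤1+∣p-x∣ (inside  ∷ p) zero    = s≤s (≤-reflexive (cong ∣_∣ (sym (p─⊥≡p p))))
∣p∣≤1+∣p-x∣ (outside ∷ p) zero    = ≤-trans (≤-reflexive (cong ∣_∣ (sym (p─⊥≡p p)))) (n≤1+n _)
∣p∣≤1+∣p-x∣ (inside  ∷ p) (suc x) = s≤s (∣p∣≤1+∣p-x∣ p x)
∣p∣≤1+∣p-x∣ (outside ∷ p) (suc x) = ∣p∣≤1+∣p-x∣ p x

x∉p⇒∣p∣<∣p∪⁅x⁆∣ : ∀ {p : Subset n} {x} → x ∉ p → ∣ p ∣ < ∣ p ∪ ⁅ x ⁆ ∣
x∉p⇒∣p∣<∣p∪⁅x⁆∣ {x = x} x∉p =
  p⊂q⇒∣p∣<∣q∣ (p⊆p∪q ⁅ x ⁆ , x , x∈p∪q⁺ (inj₂ (x∈⁅x⁆ x)) , x∉p)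

x∈p∪⁅y⁆⁻ : ∀ {p : Subset n} {x y} → x ∈ p ∪ ⁅ y ⁆ → x ∈ p ⊎ x ≡ y
x∈p∪⁅y⁆⁻ {p = p} {y = y} x∈ with x∈p∪q⁻ p ⁅ y ⁆ x∈
... | inj₁ x∈p = inj₁ x∈p
... | inj₂ x∈y = inj₂ (x∈⁅y⁆⇒x≡y y x∈y)

x∉p∪⁅y⁆ : ∀ {p : Subset n} {x y} → x ∉ p → x ≢ y → x ∉ p ∪ ⁅ y ⁆
x∉p∪⁅y⁆ x∉p x≢y x∈ with x∈p∪⁅y⁆⁻ x∈
... | inj₁ x∈p = x∉p x∈p
... | inj₂ x≡y = x≢y x≡y

x∈p─q⇒x∉q : ∀ (p q : Subset n) {x} → x ∈ p ─ q → x ∉ q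
x∈p─q⇒x∉q (_ ∷ p) (outside ∷ q) here        ()
x∈p─q⇒x∉q (_ ∷ p) (_       ∷ q) (there x∈) (there x∈q) = x∈p─q⇒x∉q p q x∈ x∈q

x∈p-y⇒x≢y : ∀ {p : Subset n} {x y} → x ∈ p - y → x ≢ y
x∈p-y⇒x≢y {p = p} x∈ refl = x∈p─q⇒x∉q p _ x∈ (x∈⁅x⁆ _)

exchange : Subset n → Fin n → Fin n → Fin n → Fin n → Subset n
exchange p w x y z = ((p ∪ ⁅ x ⁆) ∪ ⁅ y ⁆) ∪ ⁅ z ⁆ - w

∣p∣+2≤∣exchange∣ : ∀ {p : Subset n} {x y z} w → x ∉ p → y ∉ p → z ∉ p → x ≢ y → z ≢ x → z ≢ y →
                   2 + ∣ p ∣ ≤ ∣ exchange p w x y z ∣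
∣p∣+2≤∣exchange∣ {p = p} {x} {y} {z} w x∉p y∉p z∉p x≢y z≢x z≢y = ≤-pred (begin
  3 + ∣ p ∣                         ≤⟨ s≤s (s≤s (x∉p⇒∣p∣<∣p∪⁅x⁆∣ x∉p)) ⟩
  2 + ∣ p ∪ ⁅ x ⁆ ∣                 ≤⟨ s≤s (x∉p⇒∣p∣<∣p∪⁅x⁆∣ (x∉p∪⁅y⁆ y∉p (≢-sym x≢y))) ⟩
  1 + ∣ (p ∪ ⁅ x ⁆) ∪ ⁅ y ⁆ ∣       ≤⟨ x∉p⇒∣p∣<∣p∪⁅x⁆∣ (x∉p∪⁅y⁆ (x∉p∪⁅y⁆ z∉p z≢x) z≢y) ⟩
  ∣ ((p ∪ ⁅ x ⁆) ∪ ⁅ y ⁆) ∪ ⁅ z ⁆ ∣ ≤⟨ ∣p∣≤1+∣p-x∣ (((p ∪ ⁅ x ⁆) ∪ ⁅ y ⁆) ∪ ⁅ z ⁆) w ⟩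
  1 + ∣ exchange p w x y z ∣         ∎)
  where open ≤-Reasoning

linked-lookup : ∀ {A : Set} {R : A → A → Set} {m} {xs : Vec A m} → Linked R xs →
                ∀ i j → toℕ j ≡ suc (toℕ i) → R (lookup xs i) (lookup xs j)
linked-lookup [-]                              zero    zero          ()
linked-lookup                  (_ ∷ _)         zero    zero          ()
linked-lookup {xs = _ ∷ _ ∷ _} (x~y ∷ _)       zero    (suc zero)    refl = x~y
linked-lookup                  (_ ∷ _)         zero    (suc (suc _)) ()
linked-lookup                  (_ ∷ _)         (suc _) zero          ()
linked-lookup                  (_ ∷ linked)    (suc i) (suc j)       eq   =
  linked-lookup linked i j (suc-injective eq)

module _ (G : Graph n) where

  adj? : ∀ x y → Dec (Adj G x y)
  adj? x y = adj G x y Bool.≟ true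

  adj-sym : ∀ {x y} → Adj G x y → Adj G y x
  adj-sym {x} {y} x~y = trans (Graph.sym G y x) x~y

  adj-irrefl : ∀ {x} → ¬ Adj G x x
  adj-irrefl {x} x~x with trans (sym x~x) (irrefl G x)
  ... | ()

  adj⇒≢ : ∀ {x y} → Adj G x y → x ≢ y
  adj⇒≢ x~y refl = adj-irrefl x~y

  closedWalk⇒Cycle : ∀ {m} (xs : Vec (Fin n) (suc m)) → 2 ≤ m → Unique xs → Linked (Adj G) xs →
                     Adj G (lookup xs (fromℕ m)) (lookup xs zero) → Cycle G m
  closedWalk⇒Cycle xs 2≤m unique linked closing =
    2≤m , lookup xs , (λ {i} {j} → lookup-injective unique i j) , linked-lookup linked , closing

  module _ (girth : GirthAtLeast6 G) where

    no-triangle : ∀ {a b c} → Adj G a b → Adj G b c → Adj G c a → ⊥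
    no-triangle {a} {b} {c} a~b b~c c~a = girth 2 (from-yes (3 <? 6))
      (closedWalk⇒Cycle (a ∷ b ∷ c ∷ []) (s≤s (s≤s z≤n)) unique (a~b ∷ b~c ∷ [-]) c~a)
      where
      unique : Unique (a ∷ b ∷ c ∷ [])
      unique = (adj⇒≢ a~b ∷ ≢-sym (adj⇒≢ c~a) ∷ [])
             ∷ (adj⇒≢ b~c ∷ [])
             ∷ [] ∷ []

    no-square : ∀ {a b c d} → Adj G a b → Adj G b c → Adj G c d → Adj G d a → a ≢ c → b ≢ d → ⊥
    no-square {a} {b} {c} {d} a~b b~c c~d d~a a≢c b≢d = girth 3 (from-yes (4 <? 6))
      (closedWalk⇒Cycle (a ∷ b ∷ c ∷ d ∷ []) (s≤s (s≤s z≤n)) unique (a~b ∷ b~c ∷ c~d ∷ [-]) d~a)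
      where
      unique : Unique (a ∷ b ∷ c ∷ d ∷ [])
      unique = (adj⇒≢ a~b ∷ a≢c ∷ ≢-sym (adj⇒≢ d~a) ∷ [])
             ∷ (adj⇒≢ b~c ∷ b≢d ∷ [])
             ∷ (adj⇒≢ c~d ∷ [])
             ∷ [] ∷ []

    -- Any coincidence of two vertices on a closed 5-walk closes a triangle.
    no-closed-5-walk : ∀ {a b c d e} → Adj G a b → Adj G b c → Adj G c d → Adj G d e → Adj G e a → ⊥
    no-closed-5-walk {a} {b} {c} {d} {e} a~b b~c c~d d~e e~a = girth 4 (from-yes (5 <? 6))
      (closedWalk⇒Cycle (a ∷ b ∷ c ∷ d ∷ e ∷ []) (s≤s (s≤s z≤n)) unique
                        (a~b ∷ b~c ∷ c~d ∷ d~e ∷ [-]) e~a)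
      where
      unique : Unique (a ∷ b ∷ c ∷ d ∷ e ∷ [])
      unique = (adj⇒≢ a~b ∷ (λ { refl → no-triangle c~d d~e e~a })
                          ∷ (λ { refl → no-triangle a~b b~c c~d })
                          ∷ ≢-sym (adj⇒≢ e~a) ∷ [])
             ∷ (adj⇒≢ b~c ∷ (λ { refl → no-triangle d~e e~a a~b })
                          ∷ (λ { refl → no-triangle b~c c~d d~e }) ∷ [])
             ∷ (adj⇒≢ c~d ∷ (λ { refl → no-triangle e~a a~b b~c }) ∷ [])
             ∷ (adj⇒≢ d~e ∷ [])
             ∷ [] ∷ []

  independent-∪⁅x⁆ : ∀ {S x} → Independent G S → (∀ y → y ∈ S → ¬ Adj G y x) →
                     Independent G (S ∪ ⁅ x ⁆)
  independent-∪⁅x⁆ S-ind x-free y z y∈ z∈ y~z with x∈p∪⁅y⁆⁻ y∈ | x∈p∪⁅y⁆⁻ z∈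
  ... | inj₁ y∈S | inj₁ z∈S = S-ind y z y∈S z∈S y~z
  ... | inj₁ y∈S | inj₂ refl = x-free y y∈S y~z
  ... | inj₂ refl | inj₁ z∈S = x-free z z∈S (adj-sym y~z)
  ... | inj₂ refl | inj₂ refl = adj-irrefl y~z

  Addable : Subset n → Fin n → Set
  Addable S x = x ∉ S × (∀ y → y ∈ S → ¬ Adj G y x)

  addable? : ∀ S x → Dec (Addable S x)
  addable? S x = ¬? (x ∈? S) ×-dec all? (λ y → (y ∈? S) →-dec ¬? (adj? y x))

  ¬addable⇒dominating : ∀ {S} → ¬ (∃[ x ] Addable S x) → ∀ v → v ∉ S → ∃[ u ] (u ∈ S × Adj G u v)
  ¬addable⇒dominating {S} ¬addable v v∉S with any? (λ u → (u ∈? S) ×-dec adj? u v)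
  ... | yes dominated = dominated
  ... | no ¬dominated = ⊥-elim (¬addable (v , v∉S , λ u u∈S u~v → ¬dominated (u , u∈S , u~v)))

  extend-to-maximal : ∀ S → Independent G S → ∃[ M ] (S ⊆ M × MaximalIndependent G M)
  extend-to-maximal S = go n S (m≤n+m n ∣ S ∣)
    where
    open ≤-Reasoning

    go : ∀ fuel S → n ≤ ∣ S ∣ + fuel → Independent G S → ∃[ M ] (S ⊆ M × MaximalIndependent G M)
    go fuel S bound S-ind with any? (addable? S)
    ... | no ¬addable = S , id , S-ind , ¬addable⇒dominating ¬addable
    ... | yes (x , x∉S , x-free) = grow fuel bound
      where
      grow : ∀ fuel → n ≤ ∣ S ∣ + fuel → ∃[ M ] (S ⊆ M × MaximalIndependent G M)
      grow zero bound = ⊥-elim (<-irrefl refl (begin-strict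
        ∣ S ∣             <⟨ x∉p⇒∣p∣<∣p∪⁅x⁆∣ x∉S ⟩
        ∣ S ∪ ⁅ x ⁆ ∣     ≤⟨ ∣p∣≤n (S ∪ ⁅ x ⁆) ⟩
        n                 ≤⟨ bound ⟩
        ∣ S ∣ + 0         ≡⟨ +-identityʳ _ ⟩
        ∣ S ∣             ∎))
      grow (suc fuel) bound =
        let M , S∪x⊆M , M-max = go fuel (S ∪ ⁅ x ⁆) bound′ (independent-∪⁅x⁆ S-ind x-free)
        in  M , S∪x⊆M ∘ p⊆p∪q ⁅ x ⁆ , M-max
        where
        bound′ : n ≤ ∣ S ∪ ⁅ x ⁆ ∣ + fuel
        bound′ = begin
          n                    ≤⟨ bound ⟩
          ∣ S ∣ + suc fuel     ≡⟨ +-suc _ fuel ⟩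
          suc ∣ S ∣ + fuel     ≤⟨ +-monoˡ-≤ fuel (x∉p⇒∣p∣<∣p∪⁅x⁆∣ x∉S) ⟩
          ∣ S ∪ ⁅ x ⁆ ∣ + fuel ∎

  InU-adj : ∀ {x y} → InU G x → Adj G x y → InU G y
  InU-adj x∈U x~y a b y⇝a y⇝b a≢b = x∈U a b (step x~y y⇝a) (step x~y y⇝b) a≢b

  ¬InU-adj : ∀ {x y} → ¬ InU G x → Adj G x y → ¬ InU G y
  ¬InU-adj x∉U x~y y∈U = x∉U (InU-adj y∈U (adj-sym x~y))

  Pendant : Fin n → Fin n → Set
  Pendant u l = ∀ y → Adj G l y → y ≡ u

  leaf⇒pendant : ∀ {l u} → Leaf G l → Adj G l u → ¬ InU G u → Pendant u l
  leaf⇒pendant (l∉U , _ , _ , _ , only-w) l~u u∉U y l~y =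
    trans (only-w y l~y (¬InU-adj l∉U l~y)) (sym (only-w _ l~u u∉U))

  ¬Leaf⇒other-neighbour : ∀ {v w} → ¬ InU G v → Adj G v w → ¬ Leaf G w → ∃[ z ] (Adj G w z × z ≢ v)
  ¬Leaf⇒other-neighbour {v} {w} v∉U v~w w-¬leaf with any? (λ z → adj? w z ×-dec ¬? (z ≟ v))
  ... | yes other = other
  ... | no ¬other = ⊥-elim (w-¬leaf (¬InU-adj v∉U v~w , v , adj-sym v~w , v∉U , only-v))
    where
    only-v : ∀ z → Adj G w z → ¬ InU G z → z ≡ v
    only-v z w~z _ = decidable-stable (z ≟ v) (λ z≢v → ¬other (z , w~z , z≢v))

  exchange-independent : ∀ {M u l₁ l₂ v} → Independent G M → Pendant u l₁ → Pendant u l₂ →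
                         (∀ y → Adj G v y → y ≢ u → y ∉ M) →
                         Independent G (exchange M u l₁ l₂ v)
  exchange-independent {M} {u} {l₁} {l₂} {v} M-ind l₁-pendant l₂-pendant v-free x y x∈ y∈ x~y =
    exclude (classify x∈) (classify y∈)
    where
    Kind : Fin n → Set
    Kind x = x ≢ u × (Pendant u x ⊎ x ∈ M ⊎ x ≡ v)

    classify : ∀ {x} → x ∈ exchange M u l₁ l₂ v → Kind x
    classify x∈ with x∈p∪⁅y⁆⁻ (p─q⊆p _ _ x∈)
    ... | inj₂ refl = x∈p-y⇒x≢y x∈ , inj₂ (inj₂ refl)
    ... | inj₁ x∈′ with x∈p∪⁅y⁆⁻ x∈′
    ... | inj₂ refl = x∈p-y⇒x≢y x∈ , inj₁ l₂-pendant
    ... | inj₁ x∈″ with x∈p∪⁅y⁆⁻ x∈″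
    ... | inj₂ refl = x∈p-y⇒x≢y x∈ , inj₁ l₁-pendant
    ... | inj₁ x∈M  = x∈p-y⇒x≢y x∈ , inj₂ (inj₁ x∈M)

    exclude : Kind x → Kind y → ⊥
    exclude (_   , inj₁ x-pendant)   (y≢u , _)                = y≢u (x-pendant y x~y)
    exclude (x≢u , _)                (_ , inj₁ y-pendant)     = x≢u (y-pendant x (adj-sym x~y))
    exclude (_   , inj₂ (inj₁ x∈M))  (_ , inj₂ (inj₁ y∈M))    = M-ind x y x∈M y∈M x~y
    exclude (x≢u , inj₂ (inj₁ x∈M))  (_ , inj₂ (inj₂ refl))   = v-free x (adj-sym x~y) x≢u x∈M
    exclude (_   , inj₂ (inj₂ refl)) (y≢u , inj₂ (inj₁ y∈M))  = v-free y x~y y≢u y∈M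
    exclude (_   , inj₂ (inj₂ refl)) (_ , inj₂ (inj₂ refl))   = adj-irrefl x~y

  almostWellCovered⇒∣S∣≤1+∣M∣ : AlmostWellCovered G → ∀ {S M} → Independent G S →
                               MaximalIndependent G M → ∣ S ∣ ≤ suc ∣ M ∣
  almostWellCovered⇒∣S∣≤1+∣M∣ (α , i , (_ , α-max) , (_ , i-min) , α≡1+i) {S} {M} S-ind M-max =
    begin
    ∣ S ∣     ≤⟨ α-max S S-ind ⟩
    α         ≡⟨ α≡1+i ⟩
    suc i     ≤⟨ s≤s (i-min M M-max) ⟩
    suc ∣ M ∣ ∎
    where open ≤-Reasoning

  SecondNeighbourAvoiding : Fin n → Fin n → Fin n → Set
  SecondNeighbourAvoiding u v x = x ≢ v × ∃[ w ] (Adj G v w × w ≢ u × Adj G w x)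

  secondNeighbourAvoiding? : ∀ u v x → Dec (SecondNeighbourAvoiding u v x)
  secondNeighbourAvoiding? u v x =
    ¬? (x ≟ v) ×-dec any? (λ w → adj? v w ×-dec ¬? (w ≟ u) ×-dec adj? w x)

  seed? : ∀ u v x → Dec (x ≡ u ⊎ SecondNeighbourAvoiding u v x)
  seed? u v x = (x ≟ u) ⊎-dec secondNeighbourAvoiding? u v x

  seed : Fin n → Fin n → Subset n
  seed u v = subset (seed? u v)

  seed-independent : GirthAtLeast6 G → ∀ {u v} → Adj G u v → Independent G (seed u v)
  seed-independent girth {u} {v} u~v x y x∈ y∈ x~y
    with ∈-subset⁻ (seed? u v) x∈ | ∈-subset⁻ (seed? u v) y∈
  ... | inj₁ refl | inj₁ refl = adj-irrefl x~y
  ... | inj₁ refl | inj₂ (y≢v , w , v~w , w≢u , w~y) =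
    no-square girth u~v v~w w~y (adj-sym x~y) (≢-sym w≢u) (≢-sym y≢v)
  ... | inj₂ (x≢v , w , v~w , w≢u , w~x) | inj₁ refl =
    no-square girth u~v v~w w~x x~y (≢-sym w≢u) (≢-sym x≢v)
  ... | inj₂ (_ , w₁ , v~w₁ , _ , w₁~x) | inj₂ (_ , w₂ , v~w₂ , _ , w₂~y) =
    no-closed-5-walk girth v~w₁ w₁~x x~y (adj-sym w₂~y) (adj-sym v~w₂)

  seed⊆M⇒neighbours∉M : ∀ {u v M} → Independent G M → seed u v ⊆ M → ¬ InU G v →
                        (∀ w → Adj G v w → ¬ Leaf G w) → ∀ y → Adj G v y → y ≢ u → y ∉ M
  seed⊆M⇒neighbours∉M {u} {v} M-ind seed⊆M v∉U v-leafless y v~y y≢u y∈M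
    with ¬Leaf⇒other-neighbour v∉U v~y (v-leafless y v~y)
  ... | z , y~z , z≢v =
    M-ind y z y∈M (seed⊆M (∈-subset⁺ (seed? u v) (inj₂ (z≢v , y , v~y , y≢u , y~z)))) y~z

lemma3p2 : ∀ {n : ℕ} (G : Graph n) → AlmostWellCovered G → GirthAtLeast6 G
           → ∀ (u v : Fin n) → Type2 G u → Type0 G v → ¬ Adj G u v
lemma3p2 G _ _ _ _ ((u∉U , _) , _) (inj₁ v∈U) u~v = u∉U (InU-adj G v∈U (adj-sym G u~v))
lemma3p2 G awc girth u v ((u∉U , _) , l₁ , l₂ , l₁≢l₂ , u~l₁ , u~l₂ , l₁-leaf , l₂-leaf , _)
         (inj₂ ((v∉U , v-¬leaf) , v-leafless)) u~v
  with extend-to-maximal G (seed G u v) (seed-independent G girth u~v)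
... | M , seed⊆M , M-max@(M-ind , _) = <-irrefl refl (begin-strict
  suc ∣ M ∣                 <⟨ ∣p∣+2≤∣exchange∣ u (u~⇒∉M u~l₁) (u~⇒∉M u~l₂) (u~⇒∉M u~v)
                                 l₁≢l₂ (v≢leaf l₁-leaf) (v≢leaf l₂-leaf) ⟩
  ∣ exchange M u l₁ l₂ v ∣  ≤⟨ almostWellCovered⇒∣S∣≤1+∣M∣ G awc exchange-ind M-max ⟩
  suc ∣ M ∣                 ∎)
  where
  open ≤-Reasoning

  u~⇒∉M : ∀ {x} → Adj G u x → x ∉ M
  u~⇒∉M u~x x∈M = M-ind u _ (seed⊆M (∈-subset⁺ (seed? G u v) (inj₁ refl))) x∈M u~x

  v≢leaf : ∀ {l} → Leaf G l → v ≢ l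
  v≢leaf l-leaf refl = v-¬leaf l-leaf

  pendant : ∀ {l} → Adj G u l → Leaf G l → Pendant G u l
  pendant u~l l-leaf = leaf⇒pendant G l-leaf (adj-sym G u~l) u∉U

  exchange-ind : Independent G (exchange M u l₁ l₂ v)
  exchange-ind = exchange-independent G M-ind (pendant u~l₁ l₁-leaf) (pendant u~l₂ l₂-leaf)
                   (seed⊆M⇒neighbours∉M G M-ind seed⊆M v∉U v-leafless)
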